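{- Let $(A,\mathrm{Con},\vdash,\Delta)$ and $(A',\mathrm{Con}',\vdash',\Delta')$ be information systems with witnesses and let $H\subseteq\mathrm{Con}\times A'$ satisfy, for all $i,j\in A$, finite $X,X'\subseteq A$ with $X\in\mathrm{Con}(i)$, and $b\in A'$: (M2) $X'\in\mathrm{Con}(i)\wedge X\subseteq X'\wedge(i,X)Hb\Rightarrow(i,X')Hb$; (M3) $(i,X)\vdash X'\wedge(i,X')Hb\Rightarrow(i,X)Hb$; (M8) $\{i\}\in\mathrm{Con}(j)\wedge(i,X)Hb\Rightarrow(j,X)Hb$. Then the following are equivalent: (I) $H$ satisfies, for all such $i,j,X,b$: (M4) $(i,X)Hb\Rightarrow\exists U\in\mathrm{Con}(i)\,[(i,X)\vdash U\wedge(i,U)Hb]$, and (M9) $\{i\}\in\mathrm{Con}(j)\wedge(j,X)Hb\Rightarrow(i,X)Hb$; (II) for all $(i,X)\in\mathrm{Con}$ and all finite $F\subseteq A'$: if $(i,X)HF$ then there is $(c,U)\in\mathrm{Con}$ with $(i,X)\vdash(c,U)$ and $(c,U)HF$.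
   Context: An information system with witnesses is a tuple $(A,\mathrm{Con},\vdash,\Delta)$ where $A$ is a set, $\Delta\in A$, $\mathrm{Con}\subseteq A\times\mathcal{P}_f(A)$ and ${\vdash}\subseteq \mathrm{Con}\times A$. Write $X\in\mathrm{Con}(i)$ for $(i,X)\in\mathrm{Con}$; $(i,X)\vdash Y$ means $(i,X)\vdash c$ for all $c\in Y$; $(i,X)\vdash(j,Y)$ means $(i,X)\vdash j$ and $(i,X)\vdash Y$. Required for all $i,j,a\in A$ and finite $X,Y\subseteq A$: (1) $\{i\}\in\mathrm{Con}(i)$; (2) $Y\subseteq X\wedge X\in\mathrm{Con}(i)\Rightarrow Y\in\mathrm{Con}(i)$; (3) $(i,\emptyset)\vdash\Delta$; (4) $X\in\mathrm{Con}(i)\wedge(i,X)\vdash Y\Rightarrow Y\in\mathrm{Con}(i)$; (5) $X,Y\in\mathrm{Con}(i)\wedge X\subseteq Y\wedge(i,X)\vdash a\Rightarrow(i,Y)\vdash a$; (6) $X\in\mathrm{Con}(i)\wedge(i,X)\vdash Y\wedge(i,Y)\vdash a\Rightarrow(i,X)\vdash a$; (7) $(i,X)\vdash a\Rightarrow\exists Z\in\mathrm{Con}(i)\,[(i,X)\vdash Z\wedge(i,Z)\vdash a]$; (8) $(i,X)\vdash Y\Rightarrow\exists e\in A\,[(i,X)\vdash e\wedge Y\in\mathrm{Con}(e)]$; (9) $\{i\}\in\mathrm{Con}(j)\Rightarrow\mathrm{Con}(i)\subseteq\mathrm{Con}(j)$; (10) $\{i\}\in\mathrm{Con}(j)\wedge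 X\in\mathrm{Con}(i)\wedge(i,X)\vdash a\Rightarrow(j,X)\vdash a$; (11) $\{i\}\in\mathrm{Con}(j)\wedge X\in\mathrm{Con}(i)\wedge(j,X)\vdash a\Rightarrow(i,X)\vdash a$. For $H\subseteq\mathrm{Con}\times A'$ write $(i,X)Hb$ for $((i,X),b)\in H$ and $(i,X)HF$ if $(i,X)Hc$ for all $c\in F$. -}

module Defs where

open import Data.List using (List; []; [_])
open import Data.List.Membership.Propositional using (_∈_)
open import Data.List.Relation.Binary.Subset.Propositional using (_⊆_)
open import Data.List.Relation.Unary.All using (All)
open import Data.Product using (Σ; ∃; _×_; _,_)

-- Finite subsets of A are represented by lists (membership via _∈_,
-- inclusion via _⊆_).  Con(i) is a predicate Con i X; the entailment
-- (i,X) ⊢ a is  ⊢ i X a.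

record ISW : Set₁ where
  field
    A   : Set
    Δ   : A
    Con : A → List A → Set
    ⊢   : A → List A → A → Set
    ⊢-Con : ∀ {i X a} → ⊢ i X a → Con i X
    ax1  : ∀ i → Con i [ i ]
    ax2  : ∀ {i X Y} → Y ⊆ X → Con i X → Con i Y
    ax3  : ∀ i → ⊢ i [] Δ
    ax4  : ∀ {i X Y} → Con i X → All (⊢ i X) Y → Con i Y
    ax5  : ∀ {i X Y a} → Con i X → Con i Y → X ⊆ Y → ⊢ i X a → ⊢ i Y a
    ax6  : ∀ {i X Y a} → Con i X → All (⊢ i X) Y → ⊢ i Y a → ⊢ i X a
    ax7  : ∀ {i X a} → ⊢ i X a → Σ (List A) λ Z → Con i Z × All (⊢ i X) Z × ⊢ i Z a
    ax8  : ∀ {i X Y} → All (⊢ i X) Y → Σ A λ e → ⊢ i X e × Con e Y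
    ax9  : ∀ {i j} → Con j [ i ] → ∀ {X} → Con i X → Con j X
    ax10 : ∀ {i j X a} → Con j [ i ] → Con i X → ⊢ i X a → ⊢ j X a
    ax11 : ∀ {i j X a} → Con j [ i ] → Con i X → ⊢ j X a → ⊢ i X a

record Rel (S S' : ISW) : Set₁ where
  open ISW S
  open ISW S' using () renaming (A to A')
  field
    H     : A → List A → A' → Set
    H-Con : ∀ {i X b} → H i X b → Con i X

module _ {S S' : ISW} (R : Rel S S') where
  open ISW S
  open ISW S' using () renaming (A to A')
  open Rel R

  M2 : Set
  M2 = ∀ {i X X' b} → Con i X → Con i X' → X ⊆ X' → H i X b → H i X' b

  M3 : Set
  M3 = ∀ {i X X' b} → Con i X → All (⊢ i X) X' → H i X' b → H i X b

  M8 : Set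
  M8 = ∀ {i j X b} → Con i X → Con j [ i ] → H i X b → H j X b

  M4 : Set
  M4 = ∀ {i X b} → Con i X → H i X b →
       Σ (List A) λ U → Con i U × All (⊢ i X) U × H i U b

  M9 : Set
  M9 = ∀ {i j X b} → Con i X → Con j [ i ] → H j X b → H i X b

  -- (II)
  Interp : Set
  Interp = ∀ {i X} → Con i X → (F : List A') → All (H i X) F →
           Σ A λ c → Σ (List A) λ U →
             Con c U × ⊢ i X c × All (⊢ i X) U × All (H c U) F

module Submission where

open import Defs
open import Data.List using (List; []; _∷_; [_]; _++_)
open import Data.List.Relation.Unary.All as All using (All; []; _∷_)
open import Data.List.Relation.Unary.All.Properties using (++⁺)
open import Data.List.Relation.Binary.Subset.Propositional.Properties using (xs⊆xs++ys; xs⊆ys++xs)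
open import Data.Product using (_×_; Σ; _,_)
open import Function.Bundles using (_⇔_; mk⇔)

-- Condition (II) is (M4) for finitely many b at once, with the witness U
-- carried by a token c of its own.  Forwards: (M4) yields a witness for each
-- b, (M2) enlarges them all to their union, which (i,X) still entails, and
-- axiom (8) supplies c with U ∈ Con(c); since {c} ∈ Con(i), (M9) moves the
-- relation from (i,U) to (c,U).  Backwards: (M8) moves (c,U) H b back to
-- (i,U) H b, which is (M4); for (M9) apply (II) at j, transfer the
-- entailments from j to i by axiom (11) and conclude by (M3).

module ISWProperties (S : ISW) where
  open ISW S

  Con-[] : ∀ i → Con i []
  Con-[] i = ax2 (λ ()) (ax1 i)

  ⊢⇒Con-[_] : ∀ {i X} c → ⊢ i X c → Con i [ c ]
  ⊢⇒Con-[ c ] p = ax4 (⊢-Con p) (p ∷ [])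

module _ {S S' : ISW} (R : Rel S S') where
  open ISW S
  open ISW S' using () renaming (A to A')
  open ISWProperties S
  open Rel R

  M4-All : M2 R → M4 R → ∀ {i X} → Con i X → (F : List A') → All (H i X) F →
           Σ (List A) λ U → Con i U × All (⊢ i X) U × All (H i U) F
  M4-All m2 m4 {i} cX [] [] = [] , Con-[] i , [] , []
  M4-All m2 m4 cX (b ∷ F) (h ∷ hs) with m4 cX h | M4-All m2 m4 cX F hs
  ... | V , cV , ⊢V , hV | W , cW , ⊢W , hW =
    V ++ W , cV++W , ⊢V++W ,
    m2 cV cV++W (xs⊆xs++ys V W) hV ∷ All.map (m2 cW cV++W (xs⊆ys++xs W V)) hW
    where
    ⊢V++W : All (⊢ _ _) (V ++ W)
    ⊢V++W = ++⁺ ⊢V ⊢W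
    cV++W : Con _ (V ++ W)
    cV++W = ax4 cX ⊢V++W

  M8⇒H-along-⊢ : M8 R → ∀ {i X c U b} → ⊢ i X c → H c U b → H i U b
  M8⇒H-along-⊢ m8 {c = c} p h = m8 (H-Con h) (⊢⇒Con-[ c ] p) h

  M4∧M9⇒Interp : M2 R → M4 R × M9 R → Interp R
  M4∧M9⇒Interp m2 (m4 , m9) cX F hs with M4-All m2 m4 cX F hs
  ... | U , cU , ⊢U , hU with ax8 ⊢U
  ... | c , ⊢c , cU[c] = c , U , cU[c] , ⊢c , ⊢U , All.map (m9 cU[c] (⊢⇒Con-[ c ] ⊢c)) hU

  Interp⇒M4 : M8 R → Interp R → M4 R
  Interp⇒M4 m8 I {b = b} cX h with I cX [ b ] (h ∷ [])
  ... | c , U , _ , ⊢c , ⊢U , (hb ∷ []) = U , ax4 cX ⊢U , ⊢U , M8⇒H-along-⊢ m8 ⊢c hb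

  Interp⇒M9 : M3 R → M8 R → Interp R → M9 R
  Interp⇒M9 m3 m8 I {b = b} cX [i]∈Con-j h with I (ax9 [i]∈Con-j cX) [ b ] (h ∷ [])
  ... | c , U , _ , ⊢c , ⊢U , (hb ∷ []) =
    m3 cX (All.map (ax11 [i]∈Con-j cX) ⊢U) (M8⇒H-along-⊢ m8 (ax11 [i]∈Con-j cX ⊢c) hb)

lemma4p2 : (S S' : ISW) (R : Rel S S') → M2 R → M3 R → M8 R →
           ((M4 R × M9 R) ⇔ Interp R)
lemma4p2 S S' R m2 m3 m8 =
  mk⇔ (M4∧M9⇒Interp R m2) (λ I → Interp⇒M4 R m8 I , Interp⇒M9 R m3 m8 I)
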